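{- Let $m>0$ and $u,v\in\mathcal{W}(S_{2m+1})$ with $u<v$ in Bruhat order, and let $i:=\mathrm{pos}(v)$. If $\mathrm{pos}(v)<\mathrm{pos}(u)$, then $u\leqslant z$, where $z\in\mathcal{W}(S_{2m+1})$ is defined by $z=v(i,i+2)$ if $v<v(i+1,i+2)$, and $z=v(i+1,i+2)$ otherwise.
   Context: $S_n$ is the symmetric group on $[n]$ in one-line notation, $\leqslant$ Bruhat order; for a transposition $(a,b)$ of positions, $v(a,b)$ denotes the permutation obtained from $v$ by swapping the entries in positions $a$ and $b$. For $v\in S_n$, $\mathrm{pos}(v)=v^{ -1}(n)$. For $i\in[n]$ let $i^*=i-1$ if $i$ even, $i^*=i+1$ if $i$ odd and $i+1\le n$, $i^*=n$ otherwise; $\mathcal{W}(S_n)=\{\sigma\in S_n:|\sigma^{ -1}(i)-\sigma^{ -1}(i^*)|\le1\ \forall i\in[n-1]\}$. -}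

module Defs where

open import Data.Nat using (ℕ; zero; suc; _+_; _∸_; _≤_; _<_)
open import Data.Nat.Properties using (_≤?_)
open import Data.Fin using (Fin; toℕ)
open import Data.Vec using (Vec; lookup; _[_]≔_)
open import Data.Vec.Relation.Unary.Unique.Propositional using (Unique)
open import Data.Product using (_×_)
open import Relation.Binary.PropositionalEquality using (_≡_)
open import Relation.Binary.Construct.Closure.ReflexiveTransitive using (Star)
open import Relation.Nullary using (¬_; does)
open import Data.Bool using (Bool; true; false; if_then_else_)

-- Positions AND values
-- are 0-based: position p : Fin n stands for the paper's position toℕ p + 1,
-- value x : Fin n stands for the paper's value toℕ x + 1.

Perm : ℕ → Set
Perm n = Vec (Fin n) n

IsPerm : ∀ {n} → Perm n → Set
IsPerm σ = Unique σ

swap : ∀ {n} → Perm n → Fin n → Fin n → Perm n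
swap v a b = (v [ a ]≔ lookup v b) [ b ]≔ lookup v a

-- One Bruhat step in S_n: u ⟶ u(a,b) for positions a < b with u(a) < u(b)
-- (i.e. right multiplication by a transposition raising the length).
data BruhatStep {n : ℕ} : Perm n → Perm n → Set where
  step : (u : Perm n) (a b : Fin n) → toℕ a < toℕ b →
         toℕ (lookup u a) < toℕ (lookup u b) → BruhatStep u (swap u a b)

_≤B_ : ∀ {n} → Perm n → Perm n → Set
u ≤B v = Star BruhatStep u v

_<B_ : ∀ {n} → Perm n → Perm n → Set
u <B v = (u ≤B v) × ¬ (u ≡ v)

dist : ℕ → ℕ → ℕ
dist a b = (a ∸ b) + (b ∸ a)

isEven : ℕ → Bool
isEven zero = true
isEven (suc zero) = false
isEven (suc (suc k)) = isEven k

-- i* for 1-based i ∈ [n]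
star : ℕ → ℕ → ℕ
star n i = if isEven i then i ∸ 1 else (if does (suc i ≤? n) then suc i else n)

-- 𝒲(S_n): for all i ∈ [n-1], |σ⁻¹(i) − σ⁻¹(i*)| ≤ 1.
-- σ⁻¹(i) is the (unique) position p with σ(p) = i.
InW : ∀ {n} → Perm n → Set
InW {n} σ = IsPerm σ ×
  (∀ (i : ℕ) → 1 ≤ i → i ≤ n ∸ 1 → ∀ (p q : Fin n) →
     suc (toℕ (lookup σ p)) ≡ i → suc (toℕ (lookup σ q)) ≡ star n i →
     dist (toℕ p) (toℕ q) ≤ 1)

-- Bruhat order is decided by the tableau criterion: u ≤ v iff rank u j k ≤ rank v j k for all j, k,
-- where rank w j k counts the positions c < j with w(c) ≥ k.  A Bruhat step can only raise ranks;
-- conversely, if u ≠ v is rank-dominated by v, the first position where they differ yields a step from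
-- u that stays dominated, and the sum of all ranks (bounded by that of v) strictly grows.
--
-- In 𝒲(S_{2m+1}) partners 2d+1, 2d+2 occupy adjacent positions.  Left of the maximum every position
-- therefore belongs to an adjacent partner pair, so pos(v) = i is odd and v(i+1), v(i+2) are partners.
-- As pos(u) > i, the first i+2 entries of u are a union of partner pairs too: their rank counts are
-- even at even thresholds k and, at odd k, the mean of the neighbouring even counts.  Comparing with v,
-- whose first i+2 entries contain n, this parity argument gives rank u (i+2) k < rank v (i+2) k for
-- exactly the k at which the relevant swap z lowers the rank of v, so u ≤ z by the criterion.  Both
-- swaps keep partners adjacent, so z ∈ 𝒲.

module Submission where

open import Defs
open import Data.Bool using (true; false)
open import Data.Empty using (⊥; ⊥-elim)
open import Data.Fin as Fin using (Fin; toℕ; fromℕ<; punchOut)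
open import Data.Fin.Permutation.Components using (transpose; transpose-inverse)
open import Data.Fin.Properties
  using (toℕ-injective; toℕ<n; toℕ-fromℕ<; punchOut-injective; any?; <⇒notInjective)
open import Data.Nat
  using (ℕ; zero; suc; _+_; _*_; _∸_; _≤_; _<_; _≤′_; _≟_; _<?_; _≤?_; z≤n; s≤s; ≤′-refl; ≤′-step)
open import Data.Nat.Properties
open import Data.Nat.Tactic.RingSolver using (solve-∀)
open import Algebra.Properties.CommutativeSemigroup +-commutativeSemigroup using (interchange; xy∙z≈xz∙y)
open import Data.Product using (Σ; ∃; _×_; _,_; proj₁; proj₂)
open import Data.Sum using (_⊎_; inj₁; inj₂; [_,_]′)
open import Data.Vec using (Vec; []; _∷_; lookup; _[_]≔_)
open import Data.Vec.Properties using (lookup∘update; lookup∘update′; ≡-dec; tabulate∘lookup)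
open import Data.Vec.Relation.Unary.Unique.Propositional using (Unique)
open import Data.Vec.Relation.Unary.Unique.Propositional.Properties using (lookup-injective; tabulate⁺)
open import Function.Definitions using (Injective)
open import Relation.Binary using (tri<; tri≈; tri>)
open import Relation.Binary.Construct.Closure.ReflexiveTransitive using (ε; _◅_)
open import Relation.Binary.Definitions using (DecidableEquality)
open import Relation.Binary.PropositionalEquality
open import Relation.Nullary using (¬_; Dec; yes; no)
open import Relation.Nullary.Decidable using (_×-dec_; _⊎-dec_; dec-true)
open import Relation.Unary using (Decidable)

-- Indicators, sums and rank matrices

𝟙[_≤_] : ℕ → ℕ → ℕ
𝟙[ zero  ≤ _     ] = 1
𝟙[ suc k ≤ zero  ] = 0
𝟙[ suc k ≤ suc x ] = 𝟙[ k ≤ x ]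

𝟙≡1 : ∀ {k x} → k ≤ x → 𝟙[ k ≤ x ] ≡ 1
𝟙≡1 {zero}          _         = refl
𝟙≡1 {suc k} {suc x} (s≤s k≤x) = 𝟙≡1 k≤x

𝟙≡0 : ∀ {k x} → x < k → 𝟙[ k ≤ x ] ≡ 0
𝟙≡0 {suc k} {zero}  _         = refl
𝟙≡0 {suc k} {suc x} (s≤s x<k) = 𝟙≡0 x<k

𝟙≡1⇒≤ : ∀ k x → 𝟙[ k ≤ x ] ≡ 1 → k ≤ x
𝟙≡1⇒≤ zero    x       _ = z≤n
𝟙≡1⇒≤ (suc k) (suc x) e = s≤s (𝟙≡1⇒≤ k x e)

𝟙≡0⇒> : ∀ k x → 𝟙[ k ≤ x ] ≡ 0 → x < k
𝟙≡0⇒> (suc k) zero    _ = s≤s z≤n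
𝟙≡0⇒> (suc k) (suc x) e = s≤s (𝟙≡0⇒> k x e)

𝟙≡0⊎𝟙≡1 : ∀ k x → 𝟙[ k ≤ x ] ≡ 0 ⊎ 𝟙[ k ≤ x ] ≡ 1
𝟙≡0⊎𝟙≡1 zero    x       = inj₂ refl
𝟙≡0⊎𝟙≡1 (suc k) zero    = inj₁ refl
𝟙≡0⊎𝟙≡1 (suc k) (suc x) = 𝟙≡0⊎𝟙≡1 k x

𝟙≤1 : ∀ k x → 𝟙[ k ≤ x ] ≤ 1
𝟙≤1 zero    x       = ≤-refl
𝟙≤1 (suc k) zero    = z≤n
𝟙≤1 (suc k) (suc x) = 𝟙≤1 k x

𝟙-antiˡ-≤ : ∀ {k k′} x → k′ ≤ k → 𝟙[ k ≤ x ] ≤ 𝟙[ k′ ≤ x ]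
𝟙-antiˡ-≤ {k} {zero}        x       _           = 𝟙≤1 k x
𝟙-antiˡ-≤ {suc k} {suc k′}  zero    (s≤s k′≤k)  = ≤-refl
𝟙-antiˡ-≤ {suc k} {suc k′}  (suc x) (s≤s k′≤k)  = 𝟙-antiˡ-≤ x k′≤k

𝟙-window≡1 : ∀ {k h x} → k ≤ x → x ≤ h → 𝟙[ k ≤ x ] ∸ 𝟙[ suc h ≤ x ] ≡ 1
𝟙-window≡1 {k} {h} {x} k≤x x≤h rewrite 𝟙≡1 k≤x | 𝟙≡0 {suc h} {x} (s≤s x≤h) = refl

𝟙-window≡0 : ∀ {k h x} → x < k ⊎ h < x → 𝟙[ k ≤ x ] ∸ 𝟙[ suc h ≤ x ] ≡ 0
𝟙-window≡0 {k} {h} {x} (inj₁ x<k) rewrite 𝟙≡0 x<k = 0∸n≡0 𝟙[ suc h ≤ x ]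
𝟙-window≡0 {k} {h} {x} (inj₂ h<x) rewrite 𝟙≡1 h<x = m≤n⇒m∸n≡0 (𝟙≤1 k x)

sumBelow : ℕ → (ℕ → ℕ) → ℕ
sumBelow zero    f = 0
sumBelow (suc j) f = sumBelow j f + f j

sumBelow-cong : ∀ j {f g : ℕ → ℕ} → (∀ c → c < j → f c ≡ g c) → sumBelow j f ≡ sumBelow j g
sumBelow-cong zero    f≡g = refl
sumBelow-cong (suc j) f≡g = cong₂ _+_ (sumBelow-cong j (λ c c<j → f≡g c (m<n⇒m<1+n c<j))) (f≡g j ≤-refl)

sumBelow-+ : ∀ j (f g : ℕ → ℕ) → sumBelow j (λ c → f c + g c) ≡ sumBelow j f + sumBelow j g
sumBelow-+ zero    f g = refl
sumBelow-+ (suc j) f g = trans (cong (_+ (f j + g j)) (sumBelow-+ j f g)) (interchange (sumBelow j f) (sumBelow j g) (f j) (g j))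

sumBelow-mono-≤ : ∀ j {f g : ℕ → ℕ} → (∀ c → c < j → f c ≤ g c) → sumBelow j f ≤ sumBelow j g
sumBelow-mono-≤ zero    f≤g = z≤n
sumBelow-mono-≤ (suc j) f≤g = +-mono-≤ (sumBelow-mono-≤ j (λ c c<j → f≤g c (m<n⇒m<1+n c<j))) (f≤g j ≤-refl)

sumBelow-mono-< : ∀ j {f g : ℕ → ℕ} → (∀ c → c < j → f c ≤ g c) →
                  ∀ c → c < j → f c < g c → sumBelow j f < sumBelow j g
sumBelow-mono-< (suc j) f≤g c c<1+j fc<gc with c ≟ j
... | yes refl = +-mono-≤-< (sumBelow-mono-≤ c (λ d d<c → f≤g d (m<n⇒m<1+n d<c))) fc<gc
... | no c≢j   = +-mono-<-≤
  (sumBelow-mono-< j (λ d d<j → f≤g d (m<n⇒m<1+n d<j)) c (≤∧≢⇒< (≤-pred c<1+j) c≢j) fc<gc) (f≤g j ≤-refl)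

sumBelow-extend : ∀ {f g : ℕ → ℕ} {X Y j₀} → sumBelow j₀ f + X ≡ sumBelow j₀ g + Y →
                  ∀ j → j₀ ≤ j → (∀ c → j₀ ≤ c → c < j → f c ≡ g c) → sumBelow j f + X ≡ sumBelow j g + Y
sumBelow-extend {f} {g} {X} {Y} {j₀} base j j₀≤j agree = go (≤⇒≤′ j₀≤j) (λ c j₀≤c c<j → agree c j₀≤c c<j)
  where
  go : ∀ {j} → j₀ ≤′ j → (∀ c → j₀ ≤ c → c < j → f c ≡ g c) → sumBelow j f + X ≡ sumBelow j g + Y
  go ≤′-refl            _     = base
  go {suc j} (≤′-step p) agree′ = begin
    sumBelow j f + f j + X  ≡⟨ cong (λ t → sumBelow j f + t + X) (agree′ j (≤′⇒≤ p) ≤-refl) ⟩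
    sumBelow j f + g j + X  ≡⟨ xy∙z≈xz∙y _ (g j) X ⟩
    sumBelow j f + X + g j  ≡⟨ cong (_+ g j) (go p (λ c j₀≤c c<j → agree′ c j₀≤c (m<n⇒m<1+n c<j))) ⟩
    sumBelow j g + Y + g j  ≡⟨ xy∙z≈xz∙y _ Y (g j) ⟩
    sumBelow j g + g j + Y  ∎
    where open ≡-Reasoning

data Position (l : ℕ) : ℕ → Set where
  inside  : (c : Fin l) → Position l (toℕ c)
  outside : ∀ {j} → l ≤ j → Position l j

position : ∀ l j → Position l j
position zero    j       = outside z≤n
position (suc l) zero    = inside Fin.zero
position (suc l) (suc j) with position l j
... | inside c    = inside (Fin.suc c)
... | outside l≤j = outside (s≤s l≤j)

-- Entries are read at ℕ positions (0 past the end), so that position arithmetic stays in ℕ.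
at : ∀ {n l} → Vec (Fin n) l → ℕ → ℕ
at []       _       = 0
at (x ∷ _)  zero    = toℕ x
at (_ ∷ xs) (suc j) = at xs j

at-lookup : ∀ {n l} (w : Vec (Fin n) l) c → at w (toℕ c) ≡ toℕ (lookup w c)
at-lookup (x ∷ w) Fin.zero    = refl
at-lookup (x ∷ w) (Fin.suc c) = at-lookup w c

countAt : ∀ {n l} → Vec (Fin n) l → ℕ → ℕ → ℕ
countAt []       k _       = 0
countAt (x ∷ _)  k zero    = 𝟙[ k ≤ toℕ x ]
countAt (_ ∷ xs) k (suc j) = countAt xs k j

countAt-lookup : ∀ {n l} (w : Vec (Fin n) l) k c → countAt w k (toℕ c) ≡ 𝟙[ k ≤ toℕ (lookup w c) ]
countAt-lookup (x ∷ w) k Fin.zero    = refl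
countAt-lookup (x ∷ w) k (Fin.suc c) = countAt-lookup w k c

countAt-outside : ∀ {n l} (w : Vec (Fin n) l) k {j} → l ≤ j → countAt w k j ≡ 0
countAt-outside []      k _         = refl
countAt-outside (x ∷ w) k (s≤s l≤j) = countAt-outside w k l≤j

countAt-at : ∀ {n l} (w : Vec (Fin n) l) k {j} → j < l → countAt w k j ≡ 𝟙[ k ≤ at w j ]
countAt-at (x ∷ w) k {zero}  _         = refl
countAt-at (x ∷ w) k {suc j} (s≤s j<l) = countAt-at w k j<l

countAt-antiˡ-≤ : ∀ {n l} (w : Vec (Fin n) l) {k k′} j → k ≤ k′ → countAt w k′ j ≤ countAt w k j
countAt-antiˡ-≤ {l = l} w {k} {k′} j k≤k′ with position l j
... | inside c rewrite countAt-lookup w k c | countAt-lookup w k′ c = 𝟙-antiˡ-≤ _ k≤k′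
... | outside l≤j = ≤-reflexive (trans (countAt-outside w k′ l≤j) (sym (countAt-outside w k l≤j)))

countAt-cong : ∀ {n l} (u v : Vec (Fin n) l) k j → (∀ c → toℕ c ≡ j → lookup u c ≡ lookup v c) →
               countAt u k j ≡ countAt v k j
countAt-cong {l = l} u v k j same with position l j
... | inside c    = trans (countAt-lookup u k c)
                      (trans (cong (λ x → 𝟙[ k ≤ toℕ x ]) (same c refl)) (sym (countAt-lookup v k c)))
... | outside l≤j = trans (countAt-outside u k l≤j) (sym (countAt-outside v k l≤j))

rank : ∀ {n l} → Vec (Fin n) l → ℕ → ℕ → ℕ
rank w j k = sumBelow j (countAt w k)

rank-cong : ∀ {n l} (u v : Vec (Fin n) l) j k → (∀ c → toℕ c < j → lookup u c ≡ lookup v c) →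
            rank u j k ≡ rank v j k
rank-cong u v j k same =
  sumBelow-cong j (λ c c<j → countAt-cong u v k c (λ d d≡c → same d (subst (_< j) (sym d≡c) c<j)))

-- Transpositions and ranks

lookup-swapˡ : ∀ {n} (v : Perm n) a b → lookup (swap v a b) a ≡ lookup v b
lookup-swapˡ v a b with a Fin.≟ b
... | yes refl = lookup∘update a (v [ a ]≔ lookup v a) (lookup v a)
... | no a≢b   =
  trans (lookup∘update′ a≢b (v [ a ]≔ lookup v b) (lookup v a)) (lookup∘update a v (lookup v b))

lookup-swapʳ : ∀ {n} (v : Perm n) a b → lookup (swap v a b) b ≡ lookup v a
lookup-swapʳ v a b = lookup∘update b (v [ a ]≔ lookup v b) (lookup v a)

lookup-swap-other : ∀ {n} (v : Perm n) {a b} c → c ≢ a → c ≢ b → lookup (swap v a b) c ≡ lookup v c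
lookup-swap-other v {a} {b} c c≢a c≢b =
  trans (lookup∘update′ c≢b (v [ a ]≔ lookup v b) (lookup v a)) (lookup∘update′ c≢a v (lookup v b))

lookup-swap : ∀ {n} (v : Perm n) a b c → lookup (swap v a b) c ≡ lookup v (transpose a b c)
lookup-swap v a b c with c Fin.≟ a
... | yes refl = lookup-swapˡ v c b
... | no c≢a with c Fin.≟ b
...   | yes refl = lookup-swapʳ v a c
...   | no c≢b   = lookup-swap-other v c c≢a c≢b

IsPerm⇒injective : ∀ {n} {w : Perm n} → IsPerm w → Injective _≡_ _≡_ (lookup w)
IsPerm⇒injective w-perm = lookup-injective w-perm _ _

injective⇒IsPerm : ∀ {n} {w : Perm n} → Injective _≡_ _≡_ (lookup w) → IsPerm w
injective⇒IsPerm {w = w} w-inj = subst Unique (tabulate∘lookup w) (tabulate⁺ w-inj)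

injective⇒surjective : ∀ {n} (w : Perm n) → Injective _≡_ _≡_ (lookup w) → ∀ x → ∃ λ c → lookup w c ≡ x
injective⇒surjective {suc n} w w-inj x with any? (λ c → lookup w c Fin.≟ x)
... | yes hit = hit
... | no miss = ⊥-elim (<⇒notInjective (n<1+n n) squeeze-injective)
  where
  x≢at : ∀ c → x ≢ lookup w c
  x≢at c x≡wc = miss (c , sym x≡wc)
  squeeze : Fin (suc n) → Fin n
  squeeze c = punchOut (x≢at c)
  squeeze-injective : Injective _≡_ _≡_ squeeze
  squeeze-injective {c} {d} e = w-inj (punchOut-injective (x≢at c) (x≢at d) e)

swap-injective : ∀ {n} (v : Perm n) a b → Injective _≡_ _≡_ (lookup v) → Injective _≡_ _≡_ (lookup (swap v a b))
swap-injective v a b v-inj {c} {d} e = begin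
  c                                ≡⟨ transpose-inverse b a ⟨
  transpose b a (transpose a b c)  ≡⟨ cong (transpose b a) (v-inj transposed) ⟩
  transpose b a (transpose a b d)  ≡⟨ transpose-inverse b a ⟩
  d                                ∎
  where
  open ≡-Reasoning
  transposed : lookup v (transpose a b c) ≡ lookup v (transpose a b d)
  transposed = trans (sym (lookup-swap v a b c)) (trans e (lookup-swap v a b d))

module _ {n} (w : Perm n) {a b : Fin n} (a<b : toℕ a < toℕ b) (k : ℕ) where
  private
    z : Perm n
    z = swap w a b

    countAt-swap-other : ∀ c → c ≢ toℕ a → c ≢ toℕ b → countAt z k c ≡ countAt w k c
    countAt-swap-other c c≢a c≢b = countAt-cong z w k c λ d d≡c → lookup-swap-other w d
      (λ d≡a → c≢a (trans (sym d≡c) (cong toℕ d≡a))) (λ d≡b → c≢b (trans (sym d≡c) (cong toℕ d≡b)))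

  rank-swap-before : ∀ j → j ≤ toℕ a → rank z j k ≡ rank w j k
  rank-swap-before j j≤a = sumBelow-cong j λ c c<j →
    countAt-swap-other c (<⇒≢ (<-≤-trans c<j j≤a)) (<⇒≢ (<-≤-trans c<j (≤-trans j≤a (<⇒≤ a<b))))

  rank-swap-between : ∀ j → toℕ a < j → j ≤ toℕ b →
                      rank z j k + 𝟙[ k ≤ toℕ (lookup w a) ] ≡ rank w j k + 𝟙[ k ≤ toℕ (lookup w b) ]
  rank-swap-between j a<j j≤b = sumBelow-extend base j a<j λ c a<c c<j →
    countAt-swap-other c (>⇒≢ a<c) (<⇒≢ (<-≤-trans c<j j≤b))
    where
    open ≡-Reasoning
    wa wb : ℕ
    wa = 𝟙[ k ≤ toℕ (lookup w a) ]
    wb = 𝟙[ k ≤ toℕ (lookup w b) ]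
    z-a : countAt z k (toℕ a) ≡ wb
    z-a = trans (countAt-lookup z k a) (cong (λ x → 𝟙[ k ≤ toℕ x ]) (lookup-swapˡ w a b))
    base : rank z (suc (toℕ a)) k + wa ≡ rank w (suc (toℕ a)) k + wb
    base = begin
      rank z (toℕ a) k + countAt z k (toℕ a) + wa ≡⟨ cong₂ (λ r t → r + t + wa) (rank-swap-before (toℕ a) ≤-refl) z-a ⟩
      rank w (toℕ a) k + wb + wa                  ≡⟨ xy∙z≈xz∙y (rank w (toℕ a) k) wb wa ⟩
      rank w (toℕ a) k + wa + wb                  ≡⟨ cong (λ t → rank w (toℕ a) k + t + wb) (sym (countAt-lookup w k a)) ⟩
      rank w (toℕ a) k + countAt w k (toℕ a) + wb ∎

  rank-swap-after : ∀ j → toℕ b < j → rank z j k ≡ rank w j k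
  rank-swap-after j b<j = +-cancelʳ-≡ 0 _ _ (sumBelow-extend base j b<j λ c b<c _ →
    countAt-swap-other c (>⇒≢ (<-trans a<b b<c)) (>⇒≢ b<c))
    where
    base : rank z (suc (toℕ b)) k + 0 ≡ rank w (suc (toℕ b)) k + 0
    base = cong₂ _+_ (begin
      rank z (toℕ b) k + countAt z k (toℕ b)            ≡⟨ cong (rank z (toℕ b) k +_) z-b ⟩
      rank z (toℕ b) k + 𝟙[ k ≤ toℕ (lookup w a) ]      ≡⟨ rank-swap-between (toℕ b) a<b ≤-refl ⟩
      rank w (toℕ b) k + 𝟙[ k ≤ toℕ (lookup w b) ]      ≡⟨ cong (rank w (toℕ b) k +_) (countAt-lookup w k b) ⟨
      rank w (toℕ b) k + countAt w k (toℕ b)            ∎) refl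
      where
      open ≡-Reasoning
      z-b : countAt z k (toℕ b) ≡ 𝟙[ k ≤ toℕ (lookup w a) ]
      z-b = trans (countAt-lookup z k b) (cong (λ x → 𝟙[ k ≤ toℕ x ]) (lookup-swapʳ w a b))

private
  offset-cases : ∀ {r r′ x y} → r′ + x ≡ r + y → x ≡ 0 ⊎ x ≡ 1 → y ≡ 0 ⊎ y ≡ 1 →
                 r′ ≡ r ⊎ (x ≡ 0 × y ≡ 1 × r′ ≡ suc r) ⊎ (x ≡ 1 × y ≡ 0 × suc r′ ≡ r)
  offset-cases {r} {r′} e (inj₁ refl) (inj₁ refl) = inj₁ (+-cancelʳ-≡ 0 r′ r e)
  offset-cases {r} {r′} e (inj₂ refl) (inj₂ refl) = inj₁ (+-cancelʳ-≡ 1 r′ r e)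
  offset-cases {r} {r′} e (inj₁ refl) (inj₂ refl) =
    inj₂ (inj₁ (refl , refl , trans (sym (+-identityʳ r′)) (trans e (+-comm r 1))))
  offset-cases {r} {r′} e (inj₂ refl) (inj₁ refl) =
    inj₂ (inj₂ (refl , refl , trans (+-comm 1 r′) (trans e (+-identityʳ r))))

module _ {n} (w : Perm n) {a b : Fin n} (a<b : toℕ a < toℕ b) (j k : ℕ) where
  private
    z : Perm n
    z = swap w a b
    wa wb : ℕ
    wa = toℕ (lookup w a)
    wb = toℕ (lookup w b)

  rank-swap-cases : rank z j k ≡ rank w j k
                  ⊎ (toℕ a < j × j ≤ toℕ b × wa < k × k ≤ wb × rank z j k ≡ suc (rank w j k))
                  ⊎ (toℕ a < j × j ≤ toℕ b × wb < k × k ≤ wa × suc (rank z j k) ≡ rank w j k)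
  rank-swap-cases with j ≤? toℕ a | toℕ b <? j
  ... | yes j≤a | _       = inj₁ (rank-swap-before w a<b k j j≤a)
  ... | no _    | yes b<j = inj₁ (rank-swap-after w a<b k j b<j)
  ... | no j≰a  | no b≮j with offset-cases (rank-swap-between w a<b k j (≰⇒> j≰a) (≮⇒≥ b≮j))
                                          (𝟙≡0⊎𝟙≡1 k wa) (𝟙≡0⊎𝟙≡1 k wb)
  ... | inj₁ same = inj₁ same
  ... | inj₂ (inj₁ (ea , eb , raised)) =
    inj₂ (inj₁ (≰⇒> j≰a , ≮⇒≥ b≮j , 𝟙≡0⇒> k wa ea , 𝟙≡1⇒≤ k wb eb , raised))
  ... | inj₂ (inj₂ (ea , eb , lowered)) =
    inj₂ (inj₂ (≰⇒> j≰a , ≮⇒≥ b≮j , 𝟙≡0⇒> k wb eb , 𝟙≡1⇒≤ k wa ea , lowered))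

  rank-swap-≤ : ∀ {X} → rank w j k ≤ X →
                (toℕ a < j → j ≤ toℕ b → wa < k → k ≤ wb → suc (rank w j k) ≤ X) →
                rank z j k ≤ X
  rank-swap-≤ r≤X raised≤X with rank-swap-cases
  ... | inj₁ same                                  = ≤-trans (≤-reflexive same) r≤X
  ... | inj₂ (inj₁ (a<j , j≤b , wa<k , k≤wb , e)) = ≤-trans (≤-reflexive e) (raised≤X a<j j≤b wa<k k≤wb)
  ... | inj₂ (inj₂ (_ , _ , _ , _ , e))            = ≤-trans (n≤1+n _) (≤-trans (≤-reflexive e) r≤X)

  ≤-rank-swap : ∀ {X} → X ≤ rank w j k →
                (toℕ a < j → j ≤ toℕ b → wb < k → k ≤ wa → suc X ≤ rank w j k) →
                X ≤ rank z j k
  ≤-rank-swap X≤r X<lowered with rank-swap-cases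
  ... | inj₁ same                                  = ≤-trans X≤r (≤-reflexive (sym same))
  ... | inj₂ (inj₁ (_ , _ , _ , _ , e))            = ≤-trans X≤r (≤-trans (n≤1+n _) (≤-reflexive (sym e)))
  ... | inj₂ (inj₂ (a<j , j≤b , wb<k , k≤wa , e)) = ≤-pred (≤-trans (X<lowered a<j j≤b wb<k k≤wa) (≤-reflexive (sym e)))

-- The tableau criterion for Bruhat order

infix 4 _≤rank_

_≤rank_ : ∀ {n} → Perm n → Perm n → Set
u ≤rank v = ∀ j k → rank u j k ≤ rank v j k

step⇒≤rank : ∀ {n} {u w : Perm n} → BruhatStep u w → u ≤rank w
step⇒≤rank (step u a b a<b ua<ub) j k = ≤-rank-swap u a<b j k ≤-refl
  λ _ _ ub<k k≤ua → ⊥-elim (<-asym ua<ub (<-≤-trans ub<k k≤ua))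

≤B⇒≤rank : ∀ {n} {u v : Perm n} → u ≤B v → u ≤rank v
≤B⇒≤rank ε                 j k = ≤-refl
≤B⇒≤rank (u⟶w ◅ w≤v) j k = ≤-trans (step⇒≤rank u⟶w j k) (≤B⇒≤rank w≤v j k)

potential : ∀ {n} → Perm n → ℕ
potential {n} w = sumBelow (suc n) λ j → sumBelow (suc n) λ k → rank w j k

potential-mono-≤ : ∀ {n} {u v : Perm n} → u ≤rank v → potential u ≤ potential v
potential-mono-≤ {n} u≤v = sumBelow-mono-≤ (suc n) λ j _ → sumBelow-mono-≤ (suc n) λ k _ → u≤v j k

step⇒potential-< : ∀ {n} {u w : Perm n} → BruhatStep u w → potential u < potential w
step⇒potential-< {n} u⟶w@(step u a b a<b ua<ub) =
  sumBelow-mono-< (suc n) (λ j _ → sumBelow-mono-≤ (suc n) λ k _ → step⇒≤rank u⟶w j k) (suc (toℕ a)) (s≤s (toℕ<n a))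
    (sumBelow-mono-< (suc n) (λ k _ → step⇒≤rank u⟶w (suc (toℕ a)) k) ub (m<n⇒m<1+n (toℕ<n (lookup u b))) raised)
  where
  open ≤-Reasoning
  ub : ℕ
  ub = toℕ (lookup u b)
  r r′ : ℕ
  r  = rank u (suc (toℕ a)) ub
  r′ = rank (swap u a b) (suc (toℕ a)) ub
  raised : r < r′
  raised = begin-strict
    r                                  <⟨ m<m+n r (s≤s z≤n) ⟩
    r + 1                              ≡⟨ cong (r +_) (𝟙≡1 {ub} {ub} ≤-refl) ⟨
    r + 𝟙[ ub ≤ ub ]                   ≡⟨ rank-swap-between u a<b ub (suc (toℕ a)) ≤-refl a<b ⟨
    r′ + 𝟙[ ub ≤ toℕ (lookup u a) ]    ≡⟨ cong (r′ +_) (𝟙≡0 ua<ub) ⟩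
    r′ + 0                             ≡⟨ +-identityʳ r′ ⟩
    r′                                 ∎

rank-split : ∀ {n l} (w : Vec (Fin n) l) j {k} h → k ≤ suc h →
             rank w j k ≡ rank w j (suc h) + sumBelow j (λ c → countAt w k c ∸ countAt w (suc h) c)
rank-split w j {k} h k≤1+h =
  trans (sumBelow-cong j λ c _ → sym (m+[n∸m]≡n (countAt-antiˡ-≤ w c k≤1+h))) (sumBelow-+ j _ _)

firstDifference : ∀ {A : Set} {l} → DecidableEquality A → (u v : Vec A l) → u ≢ v →
                  Σ (Fin l) λ a → lookup u a ≢ lookup v a × (∀ c → toℕ c < toℕ a → lookup u c ≡ lookup v c)
firstDifference _≟ᴬ_ []      []      u≢v = ⊥-elim (u≢v refl)
firstDifference _≟ᴬ_ (x ∷ u) (y ∷ v) u≢v with x ≟ᴬ y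
... | no x≢y   = Fin.zero , x≢y , λ c ()
... | yes refl with firstDifference _≟ᴬ_ u v (λ u≡v → u≢v (cong (x ∷_) u≡v))
...   | a , ua≢va , agree = Fin.suc a , ua≢va , λ { Fin.zero _ → refl ; (Fin.suc c) (s≤s c<a) → agree c c<a }

leastWitness : (P : ℕ → Set) → Decidable P → ∀ {b} → P b → Σ ℕ λ b′ → P b′ × (∀ c → c < b′ → ¬ P c)
leastWitness P P? {zero}  Pb = zero , Pb , λ c ()
leastWitness P P? {suc b} Pb with P? zero
... | yes P0 = zero , P0 , λ c ()
... | no ¬P0 with leastWitness (λ j → P (suc j)) (λ j → P? (suc j)) Pb
...   | b′ , Pb′ , below = suc b′ , Pb′ , λ { zero _ → ¬P0 ; (suc c) (s≤s c<b′) → below c c<b′ }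

module _ {n} {u v : Perm n} (u-inj : Injective _≡_ _≡_ (lookup u)) (v-inj : Injective _≡_ _≡_ (lookup v))
         (u≤v : u ≤rank v) (u≢v : u ≢ v) where
  private
    difference : Σ (Fin n) λ a → lookup u a ≢ lookup v a × (∀ c → toℕ c < toℕ a → lookup u c ≡ lookup v c)
    difference = firstDifference Fin._≟_ u v u≢v

    a : Fin n
    a = proj₁ difference

    A ua va : ℕ
    A  = toℕ a
    ua = toℕ (lookup u a)
    va = toℕ (lookup v a)

    ua≢va : lookup u a ≢ lookup v a
    ua≢va = proj₁ (proj₂ difference)

    agree : ∀ c → toℕ c < A → lookup u c ≡ lookup v c
    agree = proj₂ (proj₂ difference)

    ua<va : ua < va
    ua<va with 𝟙≡0⊎𝟙≡1 ua va
    ... | inj₂ e = ≤∧≢⇒< (𝟙≡1⇒≤ ua va e) (λ ua≡va → ua≢va (toℕ-injective ua≡va))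
    ... | inj₁ e = ⊥-elim (1+n≰n (+-cancelˡ-≤ (rank v A ua) 1 0 (subst₂ _≤_
          (cong₂ _+_ (rank-cong u v A ua agree) (trans (countAt-lookup u ua a) (𝟙≡1 {ua} {ua} ≤-refl)))
          (cong (rank v A ua +_) (trans (countAt-lookup v ua a) e))
          (u≤v (suc A) ua))))

    -- Swapping u at a and at the least such position B is a Bruhat step that stays below v:
    -- by minimality no entry of u strictly between a and B lies in (u a, v a].
    Window : ℕ → Set
    Window j = A < j × j < n × ua < at u j × at u j ≤ va

    window? : Decidable Window
    window? j = A <? j ×-dec j <? n ×-dec ua <? at u j ×-dec at u j ≤? va

    b : Fin n
    b = proj₁ (injective⇒surjective u u-inj (lookup v a))

    ub≡va : lookup u b ≡ lookup v a
    ub≡va = proj₂ (injective⇒surjective u u-inj (lookup v a))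

    a<b : A < toℕ b
    a<b with <-cmp A (toℕ b)
    ... | tri< a<b _ _ = a<b
    ... | tri≈ _ a≡b _ = ⊥-elim (ua≢va (subst (λ c → lookup u c ≡ lookup v a) (sym (toℕ-injective a≡b)) ub≡va))
    ... | tri> _ _ b<a = ⊥-elim (<⇒≢ b<a (cong toℕ (v-inj (trans (sym (agree b b<a)) ub≡va))))

    least : Σ ℕ λ B′ → Window B′ × (∀ c → c < B′ → ¬ Window c)
    least = leastWitness Window window? {toℕ b}
      (a<b , toℕ<n b , subst (ua <_) (sym u-at-b) ua<va , ≤-reflexive u-at-b)
      where
      u-at-b : at u (toℕ b) ≡ va
      u-at-b = trans (at-lookup u b) (cong toℕ ub≡va)

    B′ : ℕ
    B′ = proj₁ least

    B : Fin n
    B = fromℕ< (proj₁ (proj₂ (proj₁ (proj₂ least))))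

    B≡B′ : toℕ B ≡ B′
    B≡B′ = toℕ-fromℕ< _

    uB : ℕ
    uB = toℕ (lookup u B)

    at-B′ : at u B′ ≡ uB
    at-B′ = trans (cong (at u) (sym B≡B′)) (at-lookup u B)

    a<B : A < toℕ B
    a<B = subst (A <_) (sym B≡B′) (proj₁ (proj₁ (proj₂ least)))

    ua<uB : ua < uB
    ua<uB = subst (ua <_) at-B′ (proj₁ (proj₂ (proj₂ (proj₁ (proj₂ least)))))

    uB≤va : uB ≤ va
    uB≤va = subst (_≤ va) at-B′ (proj₂ (proj₂ (proj₂ (proj₁ (proj₂ least)))))

    outside-window : ∀ c → A < c → c < B′ → at u c ≤ ua ⊎ va < at u c
    outside-window c a<c c<B′ with at u c ≤? ua | va <? at u c
    ... | yes ≤ua | _      = inj₁ ≤ua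
    ... | no  _   | yes va< = inj₂ va<
    ... | no ≰ua  | no ≮va  = ⊥-elim (proj₂ (proj₂ least) c c<B′
                                (a<c , <-trans c<B′ (subst (_< n) B≡B′ (toℕ<n B)) , ≰⇒> ≰ua , ≮⇒≥ ≮va))

    inWindow : Perm n → ℕ → ℕ → ℕ
    inWindow w k c = countAt w k c ∸ countAt w (suc va) c

    module _ {k} (ua<k : ua < k) (k≤va : k ≤ va) where
      inWindow-u-a : inWindow u k A ≡ 0
      inWindow-u-a = trans (cong (_∸ countAt u (suc va) A) (trans (countAt-lookup u k a) (𝟙≡0 ua<k)))
                           (0∸n≡0 (countAt u (suc va) A))

      inWindow-v-a : inWindow v k A ≡ 1
      inWindow-v-a rewrite countAt-lookup v k a | countAt-lookup v (suc va) a = 𝟙-window≡1 k≤va ≤-refl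

      inWindow-≤ : ∀ c → c < B′ → inWindow u k c ≤ inWindow v k c
      inWindow-≤ c c<B′ with <-cmp c A
      ... | tri< c<A _ _ = ≤-reflexive (cong₂ _∸_ (countAt-cong u v k c same) (countAt-cong u v (suc va) c same))
        where
        same : ∀ d → toℕ d ≡ c → lookup u d ≡ lookup v d
        same d d≡c = agree d (subst (_< A) (sym d≡c) c<A)
      ... | tri≈ _ refl _ = ≤-trans (≤-reflexive inWindow-u-a) z≤n
      ... | tri> _ _ a<c = ≤-trans (≤-reflexive zero-in-window) z≤n
        where
        c<n : c < n
        c<n = <-trans c<B′ (subst (_< n) B≡B′ (toℕ<n B))
        zero-in-window : inWindow u k c ≡ 0
        zero-in-window rewrite countAt-at u k c<n | countAt-at u (suc va) c<n
          with outside-window c a<c c<B′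
        ... | inj₁ ≤ua = 𝟙-window≡0 (inj₁ (≤-<-trans ≤ua ua<k))
        ... | inj₂ va< = 𝟙-window≡0 {k} (inj₂ va<)

      rank-gap : ∀ j → A < j → j ≤ B′ → suc (rank u j k) ≤ rank v j k
      rank-gap j a<j j≤B′ = begin
        suc (rank u j k)                                           ≡⟨ cong suc (rank-split u j va k≤1+va) ⟩
        suc (rank u j (suc va) + sumBelow j (inWindow u k))        ≡⟨ +-suc _ _ ⟨
        rank u j (suc va) + suc (sumBelow j (inWindow u k))        ≤⟨ +-mono-≤ (u≤v j (suc va)) window-< ⟩
        rank v j (suc va) + sumBelow j (inWindow v k)              ≡⟨ rank-split v j va k≤1+va ⟨
        rank v j k                                                 ∎
        where
        open ≤-Reasoning
        k≤1+va : k ≤ suc va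
        k≤1+va = m≤n⇒m≤1+n k≤va
        window-< : sumBelow j (inWindow u k) < sumBelow j (inWindow v k)
        window-< = sumBelow-mono-< j (λ c c<j → inWindow-≤ c (<-≤-trans c<j j≤B′)) A a<j
                     (subst₂ _<_ (sym inWindow-u-a) (sym inWindow-v-a) (s≤s z≤n))

  ≤rank-step : Σ (Perm n) λ u′ → BruhatStep u u′ × u′ ≤rank v
  ≤rank-step = swap u a B , step u a B a<B ua<uB , λ j k → rank-swap-≤ u a<B j k (u≤v j k)
    λ a<j j≤B ua<k k≤uB → rank-gap ua<k (≤-trans k≤uB uB≤va) j a<j (subst (j ≤_) B≡B′ j≤B)

step-injective : ∀ {n} {u w : Perm n} → BruhatStep u w → Injective _≡_ _≡_ (lookup u) → Injective _≡_ _≡_ (lookup w)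
step-injective (step u a b _ _) = swap-injective u a b

≤rank⇒≤B : ∀ {n} {u v : Perm n} → IsPerm u → IsPerm v → u ≤rank v → u ≤B v
≤rank⇒≤B {n} {u} {v} u-perm v-perm u≤v = climb (potential v) (IsPerm⇒injective u-perm) u≤v (m≤m+n _ _)
  where
  climb : ∀ fuel {u} → Injective _≡_ _≡_ (lookup u) → u ≤rank v → potential v ≤ fuel + potential u → u ≤B v
  climb fuel {u} u-inj u≤v bound with ≡-dec Fin._≟_ u v
  ... | yes refl = ε
  ... | no u≢v with ≤rank-step u-inj (IsPerm⇒injective v-perm) u≤v u≢v
  ...   | u′ , u⟶u′ , u′≤v = u⟶u′ ◅ continue fuel bound
    where
    gain : potential u < potential u′
    gain = step⇒potential-< u⟶u′
    continue : ∀ fuel → potential v ≤ fuel + potential u → u′ ≤B v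
    continue zero       bound′ = ⊥-elim (<⇒≱ gain (≤-trans (potential-mono-≤ {u = u′} {v} u′≤v) bound′))
    continue (suc fuel) bound′ = climb fuel (step-injective u⟶u′ u-inj) u′≤v
      (≤-trans bound′ (subst (_≤ fuel + potential u′) (+-suc fuel (potential u)) (+-monoʳ-≤ fuel gain)))

-- Parity, partners and 𝒲(S_{2m+1})

double : ℕ → ℕ
double zero    = zero
double (suc d) = suc (suc (double d))

double≡2* : ∀ d → double d ≡ 2 * d
double≡2* zero    = refl
double≡2* (suc d) = cong suc (trans (cong suc (double≡2* d)) (sym (+-suc d (d + 0))))

double-mono-≤ : ∀ {a b} → a ≤ b → double a ≤ double b
double-mono-≤ z≤n       = z≤n
double-mono-≤ (s≤s a≤b) = s≤s (s≤s (double-mono-≤ a≤b))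

double-cancel-< : ∀ {a b} → double a < double b → a < b
double-cancel-< {zero}  {suc b} _               = s≤s z≤n
double-cancel-< {suc a} {suc b} (s≤s (s≤s a<b)) = s≤s (double-cancel-< a<b)

data Parity : ℕ → Set where
  even : ∀ d → Parity (double d)
  odd  : ∀ d → Parity (suc (double d))

parity : ∀ x → Parity x
parity zero          = even zero
parity (suc zero)    = odd zero
parity (suc (suc x)) with parity x
... | even d = even (suc d)
... | odd  d = odd (suc d)

parity-split : ∀ x → (∃ λ c → x ≡ double c) ⊎ (∃ λ c → x ≡ suc (double c))
parity-split x with parity x
... | even c = inj₁ (c , refl)
... | odd c  = inj₂ (c , refl)

*2-≤-suc : ∀ a b → 2 * a ≤ suc (2 * b) → 2 * a ≤ 2 * b
*2-≤-suc a b 2a≤1+2b = *-monoʳ-≤ 2 (≤-pred (*-cancelˡ-< 2 a (suc b) (subst (2 * a <_) (sym (*-suc 2 b)) (s≤s 2a≤1+2b))))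

-- 0-based values 2d and 2d+1 are the paper's partners 2d+1 and 2d+2; the top value 2m is unpaired.
partner : ℕ → ℕ
partner zero          = 1
partner (suc zero)    = 0
partner (suc (suc x)) = suc (suc (partner x))

partner-even : ∀ d → partner (double d) ≡ suc (double d)
partner-even zero    = refl
partner-even (suc d) = cong (λ x → suc (suc x)) (partner-even d)

partner-odd : ∀ d → partner (suc (double d)) ≡ double d
partner-odd zero    = refl
partner-odd (suc d) = cong (λ x → suc (suc x)) (partner-odd d)

partner-involutive : ∀ x → partner (partner x) ≡ x
partner-involutive zero          = refl
partner-involutive (suc zero)    = refl
partner-involutive (suc (suc x)) = cong (λ y → suc (suc y)) (partner-involutive x)

partner-≢ : ∀ x → partner x ≢ x
partner-≢ (suc (suc x)) e = partner-≢ x (suc-injective (suc-injective e))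

partner-< : ∀ {x m} → x < double m → partner x < double m
partner-< {zero}        {suc m} _               = s≤s (s≤s z≤n)
partner-< {suc zero}    {suc m} _               = s≤s z≤n
partner-< {suc (suc x)} {suc m} (s≤s (s≤s x<m)) = s≤s (s≤s (partner-< x<m))

isEven-double : ∀ d → isEven (double d) ≡ true
isEven-double zero    = refl
isEven-double (suc d) = isEven-double d

isEven-suc-double : ∀ d → isEven (suc (double d)) ≡ false
isEven-suc-double zero    = refl
isEven-suc-double (suc d) = isEven-suc-double d

2*m+1≡1+double : ∀ m → 2 * m + 1 ≡ suc (double m)
2*m+1≡1+double m = trans (+-comm (2 * m) 1) (cong suc (sym (double≡2* m)))

2*m+1∸1 : ∀ m → 2 * m + 1 ∸ 1 ≡ double m
2*m+1∸1 m = cong (_∸ 1) (2*m+1≡1+double m)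

double<2*m+1 : ∀ m → double m < 2 * m + 1
double<2*m+1 m = subst (double m <_) (sym (2*m+1≡1+double m)) (n<1+n (double m))

star-partner : ∀ m x → x < double m → star (2 * m + 1) (suc x) ≡ suc (partner x)
star-partner m x x<2m with parity x
... | odd d  rewrite isEven-double (suc d) | partner-odd d = refl
... | even d rewrite isEven-suc-double d | partner-even d
                   | dec-true (suc (suc (double d)) ≤? 2 * m + 1) (≤-trans (s≤s x<2m) (double<2*m+1 m)) = refl

partner-<-odd : ∀ {x s} → x < suc (double s) → partner x < suc (double s) → x < double s
partner-<-odd {x} {s} x<1+2s px<1+2s = ≤∧≢⇒< (≤-pred x<1+2s) λ { refl → <-irrefl (partner-even s) px<1+2s }

partner-sym : ∀ {x y} → y ≡ partner x → x ≡ partner y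
partner-sym {x} y≡ = trans (sym (partner-involutive x)) (cong partner (sym y≡))

partner-injective : ∀ {x y} → partner x ≡ partner y → x ≡ y
partner-injective {x} {y} e = trans (sym (partner-involutive x)) (trans (cong partner e) (partner-involutive y))

𝟙-double-partner : ∀ s x → 𝟙[ double s ≤ x ] ≡ 𝟙[ double s ≤ partner x ]
𝟙-double-partner zero    x             = refl
𝟙-double-partner (suc s) zero          = refl
𝟙-double-partner (suc s) (suc zero)    = refl
𝟙-double-partner (suc s) (suc (suc x)) = 𝟙-double-partner s x

𝟙-pair-midpoint : ∀ s x → (𝟙[ double s ≤ x ] + 𝟙[ double s ≤ partner x ])
                          + (𝟙[ double (suc s) ≤ x ] + 𝟙[ double (suc s) ≤ partner x ])
                          ≡ 2 * (𝟙[ suc (double s) ≤ x ] + 𝟙[ suc (double s) ≤ partner x ])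
𝟙-pair-midpoint zero    zero          = refl
𝟙-pair-midpoint zero    (suc zero)    = refl
𝟙-pair-midpoint zero    (suc (suc x)) = refl
𝟙-pair-midpoint (suc s) zero          = refl
𝟙-pair-midpoint (suc s) (suc zero)    = refl
𝟙-pair-midpoint (suc s) (suc (suc x)) = 𝟙-pair-midpoint s x

PairedPrefix : ∀ {n l} → Vec (Fin n) l → ℕ → Set
PairedPrefix {l = l} w d = ∀ t → t < d → suc (double t) < l × at w (suc (double t)) ≡ partner (at w (double t))

module _ {n l} (w : Vec (Fin n) l) where
  rank-pair-step : ∀ {d} → PairedPrefix w (suc d) → ∀ k → rank w (double (suc d)) k ≡
                   rank w (double d) k + 𝟙[ k ≤ at w (double d) ] + 𝟙[ k ≤ partner (at w (double d)) ]
  rank-pair-step {d} paired k with paired d ≤-refl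
  ... | 1+2d<l , pair rewrite countAt-at w k (<-trans (n<1+n _) 1+2d<l) | countAt-at w k 1+2d<l | pair = refl

  private
    shorter : ∀ {d} → PairedPrefix w (suc d) → PairedPrefix w d
    shorter paired t t<d = paired t (m<n⇒m<1+n t<d)

  rank-paired-even : ∀ d → PairedPrefix w d → ∀ s → ∃ λ h → rank w (double d) (double s) ≡ 2 * h
  rank-paired-even zero    _      s = 0 , refl
  rank-paired-even (suc d) paired s with rank-paired-even d (shorter paired) s
  ... | h , rank≡2h = h + e , (begin
      rank w (double (suc d)) (double s)                    ≡⟨ rank-pair-step paired (double s) ⟩
      rank w (double d) (double s) + e + 𝟙[ double s ≤ partner x ] ≡⟨ cong₂ (λ r t → r + e + t) rank≡2h (sym (𝟙-double-partner s x)) ⟩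
      2 * h + e + e                                         ≡⟨ twice h e ⟩
      2 * (h + e)                                           ∎)
    where
    open ≡-Reasoning
    x e : ℕ
    x = at w (double d)
    e = 𝟙[ double s ≤ x ]
    twice : ∀ h a → 2 * h + a + a ≡ 2 * (h + a)
    twice = solve-∀

  rank-paired-midpoint : ∀ d → PairedPrefix w d → ∀ s →
                         rank w (double d) (double s) + rank w (double d) (double (suc s)) ≡ 2 * rank w (double d) (suc (double s))
  rank-paired-midpoint zero    _      s = refl
  rank-paired-midpoint (suc d) paired s
    rewrite rank-pair-step paired (double s) | rank-pair-step paired (double (suc s)) | rank-pair-step paired (suc (double s)) =
    trans (regroup (rank w (double d) (double s)) (rank w (double d) (double (suc s))) _ _ _ _)
          (trans (cong₂ _+_ (rank-paired-midpoint d (shorter paired) s) (𝟙-pair-midpoint s (at w (double d))))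
                 (ungroup (rank w (double d) (suc (double s))) _ _))
    where
    regroup : ∀ A B a₁ a₂ b₁ b₂ → (A + a₁ + a₂) + (B + b₁ + b₂) ≡ (A + B) + ((a₁ + a₂) + (b₁ + b₂))
    regroup = solve-∀
    ungroup : ∀ C c₁ c₂ → 2 * C + 2 * (c₁ + c₂) ≡ 2 * (C + c₁ + c₂)
    ungroup = solve-∀

dist-comm : ∀ a b → dist a b ≡ dist b a
dist-comm a b = +-comm (a ∸ b) (b ∸ a)

dist-suc : ∀ a → dist a (suc a) ≤ 1
dist-suc zero    = ≤-refl
dist-suc (suc a) = dist-suc a

dist≤1⇒adjacent : ∀ {a b} → dist a b ≤ 1 → a ≢ b → b ≡ suc a ⊎ a ≡ suc b
dist≤1⇒adjacent {zero}        {zero}        _ a≢b = ⊥-elim (a≢b refl)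
dist≤1⇒adjacent {zero}        {suc zero}    _ _   = inj₁ refl
dist≤1⇒adjacent {suc zero}    {zero}        _ _   = inj₂ refl
dist≤1⇒adjacent {suc a}       {suc b}       d a≢b with dist≤1⇒adjacent {a} {b} d (λ a≡b → a≢b (cong suc a≡b))
... | inj₁ b≡1+a = inj₁ (cong suc b≡1+a)
... | inj₂ a≡1+b = inj₂ (cong suc a≡1+b)
dist≤1⇒adjacent {zero}        {suc (suc b)} (s≤s ())
dist≤1⇒adjacent {suc (suc a)} {zero}        (s≤s ())

PartnersAdjacent : ∀ m → Perm (2 * m + 1) → Set
PartnersAdjacent m w = ∀ p q → toℕ (lookup w p) < double m → toℕ (lookup w q) ≡ partner (toℕ (lookup w p)) →
                       dist (toℕ p) (toℕ q) ≤ 1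

InW⇒partnersAdjacent : ∀ m {w : Perm (2 * m + 1)} → InW w → PartnersAdjacent m w
InW⇒partnersAdjacent m {w} (_ , adjacent) p q wp<2m wq≡ = adjacent (suc (toℕ (lookup w p))) (s≤s z≤n)
  (subst (suc (toℕ (lookup w p)) ≤_) (sym (2*m+1∸1 m)) wp<2m) p q refl
  (trans (cong suc wq≡) (sym (star-partner m _ wp<2m)))

partnersAdjacent⇒InW : ∀ m {w : Perm (2 * m + 1)} → IsPerm w → PartnersAdjacent m w → InW w
partnersAdjacent⇒InW m {w} w-perm adjacent = w-perm , star-adjacent
  where
  star-adjacent : ∀ i → 1 ≤ i → i ≤ 2 * m + 1 ∸ 1 → ∀ p q → suc (toℕ (lookup w p)) ≡ i →
                  suc (toℕ (lookup w q)) ≡ star (2 * m + 1) i → dist (toℕ p) (toℕ q) ≤ 1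
  star-adjacent .(suc (toℕ (lookup w p))) _ i≤2m p q refl wq≡ =
    adjacent p q wp<2m (suc-injective (trans wq≡ (star-partner m _ wp<2m)))
    where
    wp<2m : toℕ (lookup w p) < double m
    wp<2m = subst (suc (toℕ (lookup w p)) ≤_) (2*m+1∸1 m) i≤2m

partnersAdjacent-swap : ∀ m {w : Perm (2 * m + 1)} {a b} → PartnersAdjacent m w →
  (∀ p q → p ≡ a ⊎ p ≡ b → toℕ (lookup (swap w a b) p) < double m →
           toℕ (lookup (swap w a b) q) ≡ partner (toℕ (lookup (swap w a b) p)) → dist (toℕ p) (toℕ q) ≤ 1) →
  PartnersAdjacent m (swap w a b)
partnersAdjacent-swap m {w} {a} {b} adjacent swapped p q zp<2m zq≡ with is-swapped p | is-swapped q
  where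
  is-swapped : ∀ c → Dec (c ≡ a ⊎ c ≡ b)
  is-swapped c = c Fin.≟ a ⊎-dec c Fin.≟ b
... | yes p∈ | _      = swapped p q p∈ zp<2m zq≡
... | no _   | yes q∈ = subst (_≤ 1) (dist-comm (toℕ q) (toℕ p))
  (swapped q p q∈ (subst (_< double m) (sym zq≡) (partner-< zp<2m)) (partner-sym zq≡))
... | no p∉  | no q∉  = adjacent p q
  (subst (_< double m) (cong toℕ (unmoved p p∉)) zp<2m)
  (subst₂ (λ x y → toℕ x ≡ partner (toℕ y)) (unmoved q q∉) (unmoved p p∉) zq≡)
  where
  unmoved : ∀ c → ¬ (c ≡ a ⊎ c ≡ b) → lookup (swap w a b) c ≡ lookup w c
  unmoved c c∉ = lookup-swap-other w c (λ c≡a → c∉ (inj₁ c≡a)) (λ c≡b → c∉ (inj₂ c≡b))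

module InW-structure m {w : Perm (2 * m + 1)} (w∈W : InW w) where
  private
    n : ℕ
    n = 2 * m + 1

  at-≤ : ∀ {j} → j < n → at w j ≤ double m
  at-≤ {j} j<n with position n j
  ... | outside n≤j = ⊥-elim (<⇒≱ j<n n≤j)
  ... | inside c    =
    subst (_≤ double m) (sym (at-lookup w c)) (≤-pred (subst (toℕ (lookup w c) <_) (2*m+1≡1+double m) (toℕ<n _)))

  at-injective : ∀ {j j′} → j < n → j′ < n → at w j ≡ at w j′ → j ≡ j′
  at-injective {j} {j′} j<n j′<n e with position n j | position n j′
  ... | outside n≤j | _            = ⊥-elim (<⇒≱ j<n n≤j)
  ... | _           | outside n≤j′ = ⊥-elim (<⇒≱ j′<n n≤j′)
  ... | inside c    | inside c′    =
    cong toℕ (IsPerm⇒injective (proj₁ w∈W) (toℕ-injective (trans (sym (at-lookup w c)) (trans e (at-lookup w c′)))))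

  partner-located : ∀ c → toℕ (lookup w c) < double m →
                    Σ (Fin n) λ q → at w (toℕ q) ≡ partner (at w (toℕ c)) × dist (toℕ c) (toℕ q) ≤ 1
  partner-located c wc<2m
    with injective⇒surjective w (IsPerm⇒injective (proj₁ w∈W)) (fromℕ< (<-trans (partner-< wc<2m) (double<2*m+1 m)))
  ... | q , wq≡ = q , at-q , InW⇒partnersAdjacent m w∈W c q wc<2m (trans (cong toℕ wq≡) (toℕ-fromℕ< _))
    where
    at-q : at w (toℕ q) ≡ partner (at w (toℕ c))
    at-q = trans (at-lookup w q) (trans (cong toℕ wq≡) (trans (toℕ-fromℕ< _) (cong partner (sym (at-lookup w c)))))

  partner-beside : ∀ {j} → j < n → at w j < double m →
                   (suc j < n × at w (suc j) ≡ partner (at w j)) ⊎ (Σ ℕ λ q → j ≡ suc q × at w q ≡ partner (at w j))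
  partner-beside {j} j<n x<2m with position n j
  ... | outside n≤j = ⊥-elim (<⇒≱ j<n n≤j)
  ... | inside c with partner-located c (subst (_< double m) (at-lookup w c) x<2m)
  ...   | q , at-q , near
    with dist≤1⇒adjacent near (λ c≡q → partner-≢ (at w (toℕ c)) (trans (sym at-q) (cong (at w) (sym c≡q))))
  ...     | inj₁ q≡1+c = inj₁ (subst (_< n) q≡1+c (toℕ<n q) , subst (λ p → at w p ≡ partner (at w (toℕ c))) q≡1+c at-q)
  ...     | inj₂ c≡1+q = inj₂ (toℕ q , c≡1+q , at-q)

  module _ {P} (P<n : P < n) (at-P : at w P ≡ double m) where
    below-max : ∀ {j} → j < n → j ≢ P → at w j < double m
    below-max j<n j≢P = ≤∧≢⇒< (at-≤ j<n) (λ e → j≢P (at-injective j<n P<n (trans e (sym at-P))))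

    partner-of-max-free : ∀ {j} → j < n → j ≢ P → at w P ≢ partner (at w j)
    partner-of-max-free j<n j≢P e = <-irrefl (sym (trans (sym at-P) e)) (partner-< (below-max j<n j≢P))

    paired-before-max : ∀ d → double d < P → suc (double d) < n × at w (suc (double d)) ≡ partner (at w (double d))
    paired-before-max d 2d<P with partner-beside (<-trans 2d<P P<n) (below-max (<-trans 2d<P P<n) (<⇒≢ 2d<P))
    ... | inj₁ after             = after
    ... | inj₂ (q , 2d≡1+q , at-q) = ⊥-elim (no-partner-behind d 2d<P 2d≡1+q at-q)
      where
      no-partner-behind : ∀ d {q} → double d < P → double d ≡ suc q → at w q ≡ partner (at w (double d)) → ⊥
      no-partner-behind (suc d) 2d+2<P refl at-q = <⇒≢ (<-trans (n<1+n _) (n<1+n _))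
        (at-injective (<-trans 2d<P′ P<n) (<-trans 2d+2<P P<n) (partner-injective (trans (sym pair) at-q)))
        where
        2d<P′ : double d < P
        2d<P′ = <-trans (<-trans (n<1+n _) (n<1+n _)) 2d+2<P
        pair : at w (suc (double d)) ≡ partner (at w (double d))
        pair = proj₂ (paired-before-max d 2d<P′)

    max-position-even : ∃ λ h → P ≡ double h
    max-position-even with parity P
    ... | even h = h , refl
    ... | odd h  = ⊥-elim (partner-of-max-free (<-trans (n<1+n _) P<n) (<⇒≢ (n<1+n _)) (proj₂ (paired-before-max h (n<1+n _))))

    pair-after-max : suc P < n → suc (suc P) < n × at w (suc P) < double m × at w (suc (suc P)) ≡ partner (at w (suc P))
    pair-after-max 1+P<n with partner-beside 1+P<n (below-max 1+P<n (>⇒≢ (n<1+n P)))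
    ... | inj₁ (2+P<n , pair) = 2+P<n , below-max 1+P<n (>⇒≢ (n<1+n P)) , pair
    ... | inj₂ (q , refl , at-q) = ⊥-elim (partner-of-max-free 1+P<n (>⇒≢ (n<1+n P)) at-q)

    paired-prefix : ∀ {d} → double d ≤ P → PairedPrefix w d
    paired-prefix 2d≤P t t<d = paired-before-max t (≤-trans (≤-trans (n≤1+n _) (double-mono-≤ t<d)) 2d≤P)

-- The maximum of u to the right of that of v

module MaxMovesRight m {u v : Perm (2 * m + 1)} (u∈W : InW u) (v∈W : InW v) (u≤v : u ≤rank v)
  (iF : Fin (2 * m + 1)) (v-i : toℕ (lookup v iF) ≡ 2 * m)
  (pF : Fin (2 * m + 1)) (u-p : toℕ (lookup u pF) ≡ 2 * m) (i<p : toℕ iF < toℕ pF) where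
  private
    n i p : ℕ
    n = 2 * m + 1
    i = toℕ iF
    p = toℕ pF

    at-v-i : at v i ≡ double m
    at-v-i = trans (at-lookup v iF) (trans v-i (sym (double≡2* m)))

    at-u-p : at u p ≡ double m
    at-u-p = trans (at-lookup u pF) (trans u-p (sym (double≡2* m)))

    module V = InW-structure m v∈W
    module U = InW-structure m u∈W

    half-i half-p : ℕ
    half-i = proj₁ (V.max-position-even (toℕ<n iF) at-v-i)
    half-p = proj₁ (U.max-position-even (toℕ<n pF) at-u-p)

    i≡double : i ≡ double half-i
    i≡double = proj₂ (V.max-position-even (toℕ<n iF) at-v-i)

    2+i≡double : suc (suc i) ≡ double (suc half-i)
    2+i≡double = cong (λ t → suc (suc t)) i≡double

    2+i≤p : suc (suc i) ≤ p
    2+i≤p = subst₂ _≤_ (sym 2+i≡double) (sym p≡double)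
              (double-mono-≤ (double-cancel-< (subst₂ _<_ i≡double p≡double i<p)))
      where
      p≡double : p ≡ double half-p
      p≡double = proj₂ (U.max-position-even (toℕ<n pF) at-u-p)

    1+i<n : suc i < n
    1+i<n = ≤-trans (s≤s i<p) (toℕ<n pF)

    after-max : suc (suc i) < n × at v (suc i) < double m × at v (suc (suc i)) ≡ partner (at v (suc i))
    after-max = V.pair-after-max (toℕ<n iF) at-v-i 1+i<n

  2+i<n : suc (suc i) < n
  2+i<n = proj₁ after-max

  x₁ x₂ : ℕ
  x₁ = at v (suc i)
  x₂ = at v (suc (suc i))

  x₁<2m : x₁ < double m
  x₁<2m = proj₁ (proj₂ after-max)

  x₂≡partner : x₂ ≡ partner x₁
  x₂≡partner = proj₂ (proj₂ after-max)

  private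
    u-paired : PairedPrefix u (suc half-i)
    u-paired = U.paired-prefix (toℕ<n pF) at-u-p (subst (_≤ p) 2+i≡double 2+i≤p)

    v-paired : PairedPrefix v half-i
    v-paired = V.paired-prefix (toℕ<n iF) at-v-i (≤-reflexive (sym i≡double))

    u-even : ∀ s → ∃ λ h → rank u (suc (suc i)) (double s) ≡ 2 * h
    u-even s = subst (λ j → ∃ λ h → rank u j (double s) ≡ 2 * h) (sym 2+i≡double) (rank-paired-even u (suc half-i) u-paired s)

    v-even : ∀ s → ∃ λ h → rank v i (double s) ≡ 2 * h
    v-even s = subst (λ j → ∃ λ h → rank v j (double s) ≡ 2 * h) (sym i≡double) (rank-paired-even v half-i v-paired s)

    u-midpoint : ∀ s → rank u (suc (suc i)) (double s) + rank u (suc (suc i)) (double (suc s))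
                       ≡ 2 * rank u (suc (suc i)) (suc (double s))
    u-midpoint s = subst (λ j → rank u j (double s) + rank u j (double (suc s)) ≡ 2 * rank u j (suc (double s)))
                         (sym 2+i≡double) (rank-paired-midpoint u (suc half-i) u-paired s)

    v-midpoint : ∀ s → rank v i (double s) + rank v i (double (suc s)) ≡ 2 * rank v i (suc (double s))
    v-midpoint s = subst (λ j → rank v j (double s) + rank v j (double (suc s)) ≡ 2 * rank v j (suc (double s)))
                         (sym i≡double) (rank-paired-midpoint v half-i v-paired s)

    rank-v-past-pair : ∀ k → k ≤ double m → rank v (suc (suc i)) k ≡ suc (rank v i k + 𝟙[ k ≤ x₁ ])
    rank-v-past-pair k k≤2m = begin
      rank v i k + countAt v k i + countAt v k (suc i)  ≡⟨ cong₂ (λ a b → rank v i k + a + b) max-counted (countAt-at v k 1+i<n) ⟩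
      rank v i k + 1 + 𝟙[ k ≤ x₁ ]                      ≡⟨ cong (_+ 𝟙[ k ≤ x₁ ]) (+-comm (rank v i k) 1) ⟩
      suc (rank v i k + 𝟙[ k ≤ x₁ ])                    ∎
      where
      open ≡-Reasoning
      max-counted : countAt v k i ≡ 1
      max-counted = trans (countAt-at v k (toℕ<n iF)) (trans (cong 𝟙[ k ≤_] at-v-i) (𝟙≡1 k≤2m))

    rank-v-above-x₁ : ∀ k → x₁ < k → k ≤ double m → rank v (suc (suc i)) k ≡ suc (rank v i k)
    rank-v-above-x₁ k x₁<k k≤2m =
      trans (rank-v-past-pair k k≤2m) (cong suc (trans (cong (rank v i k +_) (𝟙≡0 x₁<k)) (+-identityʳ _)))

    rank-v-upto-x₁ : ∀ k → k ≤ x₁ → rank v (suc (suc i)) k ≡ suc (rank v i k + 1)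
    rank-v-upto-x₁ k k≤x₁ =
      trans (rank-v-past-pair k (≤-trans k≤x₁ (<⇒≤ x₁<2m))) (cong (λ b → suc (rank v i k + b)) (𝟙≡1 k≤x₁))

    Ru Rv R₀ : ℕ → ℕ
    Ru = rank u (suc (suc i))
    Rv = rank v (suc (suc i))
    R₀ = rank v i

    even-gap : ∀ s → x₁ < double s → double s ≤ double m → suc (Ru (double s)) ≤ Rv (double s)
    even-gap s x₁<2s 2s≤2m = begin
      suc (Ru (double s))  ≡⟨ cong suc Ru≡2h ⟩
      suc (2 * h)          ≤⟨ s≤s (*2-≤-suc h h′ (subst₂ _≤_ Ru≡2h Rv≡ (u≤v (suc (suc i)) (double s)))) ⟩
      suc (2 * h′)         ≡⟨ Rv≡ ⟨
      Rv (double s)        ∎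
      where
      open ≤-Reasoning
      h h′ : ℕ
      h = proj₁ (u-even s)
      h′ = proj₁ (v-even s)
      Ru≡2h : Ru (double s) ≡ 2 * h
      Ru≡2h = proj₂ (u-even s)
      R₀≡2h′ : R₀ (double s) ≡ 2 * h′
      R₀≡2h′ = proj₂ (v-even s)
      Rv≡ : Rv (double s) ≡ suc (2 * h′)
      Rv≡ = trans (rank-v-above-x₁ (double s) x₁<2s 2s≤2m) (cong suc R₀≡2h′)

    odd-gap : ∀ s → x₁ < double s → suc (double s) ≤ double m → suc (Ru (suc (double s))) ≤ Rv (suc (double s))
    odd-gap s x₁<2s 1+2s≤2m = *-cancelˡ-≤ 2 (begin
      2 * suc (Ru (suc (double s)))                  ≡⟨ *-suc 2 _ ⟩
      2 + 2 * Ru (suc (double s))                    ≡⟨ cong (2 +_) (u-midpoint s) ⟨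
      2 + (Ru (double s) + Ru (double (suc s)))      ≡⟨ two-sucs (Ru (double s)) _ ⟨
      suc (Ru (double s)) + suc (Ru (double (suc s))) ≤⟨ +-mono-≤ (even-gap s x₁<2s 2s≤2m)
                                                                  (even-gap (suc s) x₁<2s+2 2s+2≤2m) ⟩
      Rv (double s) + Rv (double (suc s))            ≡⟨ cong₂ _+_ (rank-v-above-x₁ _ x₁<2s 2s≤2m)
                                                                  (rank-v-above-x₁ _ x₁<2s+2 2s+2≤2m) ⟩
      suc (R₀ (double s)) + suc (R₀ (double (suc s))) ≡⟨ two-sucs (R₀ (double s)) _ ⟩
      2 + (R₀ (double s) + R₀ (double (suc s)))      ≡⟨ cong (2 +_) (v-midpoint s) ⟩
      2 + 2 * R₀ (suc (double s))                    ≡⟨ *-suc 2 _ ⟨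
      2 * suc (R₀ (suc (double s)))                  ≡⟨ cong (2 *_) (rank-v-above-x₁ _ (<-trans x₁<2s (n<1+n _)) 1+2s≤2m) ⟨
      2 * Rv (suc (double s))                        ∎)
      where
      open ≤-Reasoning
      two-sucs : ∀ a b → suc a + suc b ≡ 2 + (a + b)
      two-sucs a b = cong suc (+-suc a b)
      2s≤2m : double s ≤ double m
      2s≤2m = ≤-trans (n≤1+n _) 1+2s≤2m
      2s+2≤2m : double (suc s) ≤ double m
      2s+2≤2m = double-mono-≤ (double-cancel-< 1+2s≤2m)
      x₁<2s+2 : x₁ < double (suc s)
      x₁<2s+2 = <-trans x₁<2s (<-trans (n<1+n _) (n<1+n _))

  gap-above-pair : ∀ k → x₁ < k → x₂ < k → k ≤ double m → suc (Ru k) ≤ Rv k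
  gap-above-pair k x₁<k x₂<k k≤2m with parity k
  ... | even s = even-gap s x₁<k k≤2m
  ... | odd s  = odd-gap s (partner-<-odd x₁<k (subst (_< k) x₂≡partner x₂<k)) k≤2m

  gap-at-pair-top : ∀ c → x₁ ≡ suc (double c) → suc (Ru (suc (double c))) ≤ Rv (suc (double c))
  gap-at-pair-top c x₁≡ = begin
    suc (Ru t)        ≤⟨ s≤s (*-cancelˡ-≤ 2 (+-cancelʳ-≤ 1 _ _ doubled)) ⟩
    suc (suc (R₀ t))  ≡⟨ cong suc (+-comm 1 (R₀ t)) ⟩
    suc (R₀ t + 1)    ≡⟨ rank-v-upto-x₁ t (≤-reflexive (sym x₁≡)) ⟨
    Rv t              ∎
    where
    open ≤-Reasoning
    t : ℕ
    t = suc (double c)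
    2c≤x₁ : double c ≤ x₁
    2c≤x₁ = subst (double c ≤_) (sym x₁≡) (n≤1+n _)
    x₁<2c+2 : x₁ < double (suc c)
    x₁<2c+2 = subst (_< double (suc c)) (sym x₁≡) (n<1+n _)
    2c+2≤2m : double (suc c) ≤ double m
    2c+2≤2m = subst (_< double m) x₁≡ x₁<2m
    regroup : ∀ a b → suc (a + 1) + suc b ≡ a + b + 3
    regroup = solve-∀
    ungroup : ∀ a → 2 * a + 3 ≡ 2 * suc a + 1
    ungroup = solve-∀
    doubled : 2 * Ru t + 1 ≤ 2 * suc (R₀ t) + 1
    doubled = begin
      2 * Ru t + 1                                        ≡⟨ cong (_+ 1) (u-midpoint c) ⟨
      Ru (double c) + Ru (double (suc c)) + 1             ≡⟨ +-assoc (Ru (double c)) _ 1 ⟩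
      Ru (double c) + (Ru (double (suc c)) + 1)           ≡⟨ cong (Ru (double c) +_) (+-comm _ 1) ⟩
      Ru (double c) + suc (Ru (double (suc c)))           ≤⟨ +-mono-≤ (u≤v (suc (suc i)) (double c))
                                                                       (even-gap (suc c) x₁<2c+2 2c+2≤2m) ⟩
      Rv (double c) + Rv (double (suc c))                 ≡⟨ cong₂ _+_ (rank-v-upto-x₁ (double c) 2c≤x₁)
                                                                       (rank-v-above-x₁ _ x₁<2c+2 2c+2≤2m) ⟩
      suc (R₀ (double c) + 1) + suc (R₀ (double (suc c))) ≡⟨ regroup (R₀ (double c)) _ ⟩
      R₀ (double c) + R₀ (double (suc c)) + 3             ≡⟨ cong (_+ 3) (v-midpoint c) ⟩
      2 * R₀ t + 3                                        ≡⟨ ungroup (R₀ t) ⟩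
      2 * suc (R₀ t) + 1                                  ∎

  jF kF : Fin n
  jF = fromℕ< 1+i<n
  kF = fromℕ< 2+i<n

  j≡1+i : toℕ jF ≡ suc i
  j≡1+i = toℕ-fromℕ< 1+i<n

  k≡2+i : toℕ kF ≡ suc (suc i)
  k≡2+i = toℕ-fromℕ< 2+i<n

  private
    v-inj : Injective _≡_ _≡_ (lookup v)
    v-inj = IsPerm⇒injective (proj₁ v∈W)

    v-adjacent : PartnersAdjacent m v
    v-adjacent = InW⇒partnersAdjacent m v∈W

    i<k : i < toℕ kF
    i<k = subst (i <_) (sym k≡2+i) (<-trans (n<1+n i) (n<1+n _))

    j<k : toℕ jF < toℕ kF
    j<k = subst₂ _<_ (sym j≡1+i) (sym k≡2+i) (n<1+n _)

    j≢i : jF ≢ iF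
    j≢i j≡i = 1+n≢n (trans (sym j≡1+i) (cong toℕ j≡i))

    j≢k : jF ≢ kF
    j≢k j≡k = <⇒≢ j<k (cong toℕ j≡k)

    v-j : toℕ (lookup v jF) ≡ x₁
    v-j = trans (sym (at-lookup v jF)) (cong (at v) j≡1+i)

    v-k : toℕ (lookup v kF) ≡ x₂
    v-k = trans (sym (at-lookup v kF)) (cong (at v) k≡2+i)

    v-i′ : toℕ (lookup v iF) ≡ double m
    v-i′ = trans v-i (sym (double≡2* m))

    value-injective : ∀ (z : Perm n) → Injective _≡_ _≡_ (lookup z) → ∀ {q c} →
                      toℕ (lookup z q) ≡ toℕ (lookup z c) → q ≡ c
    value-injective z z-inj e = z-inj (toℕ-injective e)

    x₁≡partner : x₁ ≡ partner x₂
    x₁≡partner = partner-sym x₂≡partner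

    x₂≡1+x₁ : ∀ c → x₁ ≡ double c → x₂ ≡ suc x₁
    x₂≡1+x₁ c x₁≡ = trans x₂≡partner (trans (cong partner x₁≡) (trans (partner-even c) (cong suc (sym x₁≡))))

    x₁≡1+x₂ : ∀ c → x₁ ≡ suc (double c) → x₁ ≡ suc x₂
    x₁≡1+x₂ c x₁≡ = trans x₁≡ (cong suc (sym (trans x₂≡partner (trans (cong partner x₁≡) (partner-odd c)))))

    x₁<x₂ : ∀ c → x₁ ≡ double c → x₁ < x₂
    x₁<x₂ c x₁≡ = ≤-reflexive (sym (x₂≡1+x₁ c x₁≡))

  swap-max-InW : InW (swap v iF kF)
  swap-max-InW = partnersAdjacent⇒InW m (injective⇒IsPerm z-inj) (partnersAdjacent-swap m {v} v-adjacent moved)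
    where
    z : Perm n
    z = swap v iF kF
    z-inj : Injective _≡_ _≡_ (lookup z)
    z-inj = swap-injective v iF kF v-inj
    z-i : toℕ (lookup z iF) ≡ x₂
    z-i = trans (cong toℕ (lookup-swapˡ v iF kF)) v-k
    z-j : toℕ (lookup z jF) ≡ x₁
    z-j = trans (cong toℕ (lookup-swap-other v jF j≢i j≢k)) v-j
    moved : ∀ p q → p ≡ iF ⊎ p ≡ kF → toℕ (lookup z p) < double m →
            toℕ (lookup z q) ≡ partner (toℕ (lookup z p)) → dist (toℕ p) (toℕ q) ≤ 1
    moved p q (inj₂ refl) zk<2m _ = ⊥-elim (<-irrefl (trans (cong toℕ (lookup-swapʳ v iF kF)) v-i′) zk<2m)
    moved p q (inj₁ refl) _ zq≡ = subst (λ c → dist i c ≤ 1) (sym (trans (cong toℕ q≡j) j≡1+i)) (dist-suc i)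
      where
      q≡j : q ≡ jF
      q≡j = value-injective z z-inj (trans zq≡ (trans (cong partner z-i) (trans (sym x₁≡partner) (sym z-j))))

  swap-pair-InW : InW (swap v jF kF)
  swap-pair-InW = partnersAdjacent⇒InW m (injective⇒IsPerm z-inj) (partnersAdjacent-swap m {v} v-adjacent moved)
    where
    z : Perm n
    z = swap v jF kF
    z-inj : Injective _≡_ _≡_ (lookup z)
    z-inj = swap-injective v jF kF v-inj
    z-j : toℕ (lookup z jF) ≡ x₂
    z-j = trans (cong toℕ (lookup-swapˡ v jF kF)) v-k
    z-k : toℕ (lookup z kF) ≡ x₁
    z-k = trans (cong toℕ (lookup-swapʳ v jF kF)) v-j
    moved : ∀ p q → p ≡ jF ⊎ p ≡ kF → toℕ (lookup z p) < double m →
            toℕ (lookup z q) ≡ partner (toℕ (lookup z p)) → dist (toℕ p) (toℕ q) ≤ 1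
    moved p q (inj₁ refl) _ zq≡ =
      subst₂ (λ a b → dist a b ≤ 1) (sym j≡1+i) (sym (trans (cong toℕ q≡k) k≡2+i)) (dist-suc (suc i))
      where
      q≡k : q ≡ kF
      q≡k = value-injective z z-inj (trans zq≡ (trans (cong partner z-j) (trans (sym x₁≡partner) (sym z-k))))
    moved p q (inj₂ refl) _ zq≡ =
      subst₂ (λ a b → dist a b ≤ 1) (sym k≡2+i) (sym (trans (cong toℕ q≡j) j≡1+i))
        (subst (_≤ 1) (dist-comm (suc i) (suc (suc i))) (dist-suc (suc i)))
      where
      q≡j : q ≡ jF
      q≡j = value-injective z z-inj (trans zq≡ (trans (cong partner z-k) (trans (sym x₂≡partner) (sym z-j))))

  v<pair-swap : ∀ c → x₁ ≡ double c → v <B swap v jF kF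
  v<pair-swap c x₁≡ = step v jF kF j<k (subst₂ _<_ (sym v-j) (sym v-k) (x₁<x₂ c x₁≡)) ◅ ε , v≢z
    where
    v≢z : v ≢ swap v jF kF
    v≢z v≡z = <⇒≢ (x₁<x₂ c x₁≡)
      (trans (sym v-j) (trans (cong (λ w → toℕ (lookup w jF)) v≡z) (trans (cong toℕ (lookup-swapˡ v jF kF)) v-k)))

  v≮pair-swap : ∀ c → x₁ ≡ suc (double c) → ¬ (v <B swap v jF kF)
  v≮pair-swap c x₁≡ (v≤z , _) = <⇒≱ dropped (≤B⇒≤rank v≤z (suc (suc i)) x₁)
    where
    open ≡-Reasoning
    r r′ : ℕ
    r  = rank v (suc (suc i)) x₁
    r′ = rank (swap v jF kF) (suc (suc i)) x₁
    dropped : r′ < r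
    dropped = ≤-reflexive (begin
      suc r′                              ≡⟨ +-comm 1 r′ ⟩
      r′ + 1                              ≡⟨ cong (r′ +_) (𝟙≡1 (≤-reflexive (sym v-j))) ⟨
      r′ + 𝟙[ x₁ ≤ toℕ (lookup v jF) ]    ≡⟨ rank-swap-between v j<k x₁ (suc (suc i))
                                               (subst (_< suc (suc i)) (sym j≡1+i) (n<1+n _)) (≤-reflexive (sym k≡2+i)) ⟩
      r + 𝟙[ x₁ ≤ toℕ (lookup v kF) ]     ≡⟨ cong (r +_) (𝟙≡0 (subst (_< x₁) (sym v-k) (≤-reflexive (sym (x₁≡1+x₂ c x₁≡))))) ⟩
      r + 0                               ≡⟨ +-identityʳ r ⟩
      r                                   ∎)

  u≤max-swap : ∀ c → x₁ ≡ double c → u ≤rank swap v iF kF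
  u≤max-swap c x₁≡ j k = ≤-rank-swap v i<k j k (u≤v j k) λ i<j j≤k vk<k k≤vi →
    gap-at j (subst (j ≤_) k≡2+i j≤k) i<j (subst (_< k) v-k vk<k) (subst (k ≤_) v-i′ k≤vi)
    where
    gap-at : ∀ j → j ≤ suc (suc i) → i < j → x₂ < k → k ≤ double m → suc (rank u j k) ≤ rank v j k
    gap-at j j≤2+i i<j x₂<k k≤2m with m≤n⇒m<n∨m≡n j≤2+i
    ... | inj₂ refl = gap-above-pair k (<-trans (x₁<x₂ c x₁≡) x₂<k) x₂<k k≤2m
    ... | inj₁ j<2+i with ≤-antisym (≤-pred j<2+i) i<j
    ...   | refl = begin
      suc (rank u (suc i) k)             ≤⟨ s≤s (m≤m+n _ _) ⟩
      suc (Ru k)                         ≤⟨ gap-above-pair k (<-trans (x₁<x₂ c x₁≡) x₂<k) x₂<k k≤2m ⟩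
      Rv k                               ≡⟨ cong (rank v (suc i) k +_) (countAt-at v k 1+i<n) ⟩
      rank v (suc i) k + 𝟙[ k ≤ x₁ ]     ≡⟨ cong (rank v (suc i) k +_) (𝟙≡0 (<-trans (x₁<x₂ c x₁≡) x₂<k)) ⟩
      rank v (suc i) k + 0               ≡⟨ +-identityʳ _ ⟩
      rank v (suc i) k                   ∎
      where open ≤-Reasoning

  u≤pair-swap : ∀ c → x₁ ≡ suc (double c) → u ≤rank swap v jF kF
  u≤pair-swap c x₁≡ j k = ≤-rank-swap v j<k j k (u≤v j k) λ j<j′ j′≤k vk<k k≤vj →
    gap-at j k (≤-antisym (subst (j ≤_) k≡2+i j′≤k) (subst (_< j) j≡1+i j<j′))
               (≤-antisym (subst (k ≤_) (trans v-j x₁≡) k≤vj) (subst (_< k) (trans v-k x₂≡) vk<k))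
    where
    x₂≡ : x₂ ≡ double c
    x₂≡ = suc-injective (trans (sym (x₁≡1+x₂ c x₁≡)) x₁≡)
    gap-at : ∀ j k → j ≡ suc (suc i) → k ≡ suc (double c) → suc (rank u j k) ≤ rank v j k
    gap-at _ _ refl refl = gap-at-pair-top c x₁≡

proposition3p7 : (m : ℕ) → 0 < m →
    (u v : Perm (2 * m + 1)) → InW u → InW v → u <B v →
    (i : Fin (2 * m + 1)) → toℕ (lookup v i) ≡ 2 * m →
    (p : Fin (2 * m + 1)) → toℕ (lookup u p) ≡ 2 * m →
    toℕ i < toℕ p →
    Σ (Fin (2 * m + 1)) λ j → Σ (Fin (2 * m + 1)) λ k →
      (toℕ j ≡ suc (toℕ i)) × (toℕ k ≡ suc (suc (toℕ i))) ×
      (v <B swap v j k → InW (swap v i k) × u ≤B swap v i k) ×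
      (¬ (v <B swap v j k) → InW (swap v j k) × u ≤B swap v j k)
proposition3p7 m _ u v u∈W v∈W (u≤v , _) i v-i p u-p i<p = jF , kF , j≡1+i , k≡2+i ,
  [ (λ { (c , x₁-even) → (λ _ → swap-max-InW , ≤rank⇒≤B (proj₁ u∈W) (proj₁ swap-max-InW) (u≤max-swap c x₁-even))
                       , (λ v≮z → ⊥-elim (v≮z (v<pair-swap c x₁-even))) })
  , (λ { (c , x₁-odd)  → (λ v<z → ⊥-elim (v≮pair-swap c x₁-odd v<z))
                       , (λ _ → swap-pair-InW , ≤rank⇒≤B (proj₁ u∈W) (proj₁ swap-pair-InW) (u≤pair-swap c x₁-odd)) })
  ]′ (parity-split x₁)
  where open MaxMovesRight m u∈W v∈W (≤B⇒≤rank u≤v) i v-i p u-p i<p
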